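{- Let $(A,+)$, $(B,+)$ be finite abelian groups, $A=\{a_0,\ldots,a_{n-1}\}$, and let $f:A\to B$ be an $(n,\frac{n-1}{k}+1,k-1)$ zero-difference balanced function of Type-A such that $|f^{ -1}(0)|=1$. Then $$\mathcal{C}_f=\{(f(a_0+a_i),\ldots,f(a_{n-1}+a_i))\mid 0\le i\le n-1\}$$ is an optimal $(n,n,n-k+1,n-1)_{\frac{n-1}{k}+1}$ constant weight code.
   Context: For $f:A\to B$ with $n=|A|$, $m=|f(A)|$ and $\lambda_\alpha=|\{x\in A\mid f(x+\alpha)=f(x)\}|$ ($\alpha\neq 0$), $f$ is an $(n,m,\lambda)$ zero-difference balanced function if $\lambda_\alpha=\lambda$ for all $\alpha\in A\setminus\{0\}$. $f$ is of Type-A if the multiset of preimage sizes $\{|f^{ -1}(b)|\mid b\in f(A)\}$ equals $\{1,e,e,\ldots,e\}$ (one preimage of size 1 and $m-1$ of size $e$) for some positive integer $e$. An $(n,M,d,w)_q$ constant weight code is a code of length $n$ with $M$ codewords over an alphabet of $q$ elements of an abelian group, minimum Hamming distance $d$, every codeword having exactly $w$ nonzero coordinates; it is optimal if $nd-2nw+\frac{q}{q-1}w^2>0$ and $M=\frac{nd}{nd-2nw+\frac{q}{q-1}w^2}$. -}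

module Defs where

open import Level using (Level; _⊔_) renaming (suc to lsuc)
open import Data.Nat as ℕ using (ℕ; zero; suc; _∸_; _≤_; _<_)
open import Data.Fin using (Fin; zero; suc)
open import Data.Fin.Properties using (any?)
open import Data.Product using (Σ; ∃; _×_; _,_)
open import Data.List using (List; _∷_; map; filter; replicate; allFin)
open import Data.Empty using (⊥)
open import Data.List.Relation.Binary.Permutation.Propositional using (_↭_)
open import Data.Integer as ℤ using (ℤ; +_)
open import Data.Rational as ℚ using (ℚ; _/_; 0ℚ)
open import Algebra.Bundles using (AbelianGroup)
open import Relation.Nullary using (¬_; yes; no)
open import Relation.Binary.Definitions using (Decidable)
open import Relation.Binary.PropositionalEquality using (_≡_; _≢_)
open import Relation.Unary using (Pred)

count : ∀ {p} {n : ℕ} {P : Pred (Fin n) p} → (∀ i → Relation.Nullary.Dec (P i)) → ℕ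
count {n = zero}  P? = 0
count {n = suc n} P? with P? zero
... | yes _ = suc (count (λ i → P? (suc i)))
... | no  _ = count (λ i → P? (suc i))

record FiniteAbelianGroup (c ℓ : Level) : Set (lsuc (c ⊔ ℓ)) where
  field
    abelianGroup : AbelianGroup c ℓ
  open AbelianGroup abelianGroup public
  field
    _≟_       : Decidable _≈_
    size      : ℕ
    elem      : Fin size → Carrier
    elem-inj  : ∀ i j → elem i ≈ elem j → i ≡ j
    elem-surj : ∀ x → ∃ λ i → elem i ≈ x

open FiniteAbelianGroup using (Carrier)

module _ {c₁ ℓ₁ c₂ ℓ₂ : Level}
         (A : FiniteAbelianGroup c₁ ℓ₁) (B : FiniteAbelianGroup c₂ ℓ₂)
         (f : Carrier A → Carrier B) where

  private
    module A = FiniteAbelianGroup A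
    module B = FiniteAbelianGroup B

  preimageSize : Carrier B → ℕ
  preimageSize b = count (λ i → f (A.elem i) B.≟ b)

  InImage : Carrier B → Set ℓ₂
  InImage b = ∃ λ i → f (A.elem i) B.≈ b

  inImage? : ∀ j → Relation.Nullary.Dec (InImage (B.elem j))
  inImage? j = any? (λ i → f (A.elem i) B.≟ B.elem j)

  imageSize : ℕ
  imageSize = count inImage?

  lambda : Carrier A → ℕ
  lambda α = count (λ i → f (A.elem i A.∙ α) B.≟ f (A.elem i))

  IsZDB : ℕ → ℕ → ℕ → Set (c₁ ⊔ ℓ₁)
  IsZDB n m λ′ = (n ≡ A.size) × (m ≡ imageSize)
               × (∀ α → ¬ (α A.≈ A.ε) → lambda α ≡ λ′)

  preimageSizes : List ℕ
  preimageSizes = map (λ j → preimageSize (B.elem j))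
                      (filter inImage? (allFin B.size))

  TypeA : Set
  TypeA = Σ ℕ λ e → (1 ≤ e) × (preimageSizes ↭ (1 ∷ replicate (imageSize ∸ 1) e))

  codeword : Fin A.size → Fin A.size → Carrier B
  codeword i t = f (A.elem t A.∙ A.elem i)

module _ {c ℓ : Level} (B : FiniteAbelianGroup c ℓ) where

  private
    module B = FiniteAbelianGroup B

  hammingDistance : ∀ {n} → (Fin n → Carrier B) → (Fin n → Carrier B) → ℕ
  hammingDistance u v = count (λ t → Relation.Nullary.¬? (u t B.≟ v t))

  weight : ∀ {n} → (Fin n → Carrier B) → ℕ
  weight u = count (λ t → Relation.Nullary.¬? (u t B.≟ B.ε))

  record IsConstantWeightCode (n M d w q : ℕ) (code : Fin M → Fin n → Carrier B)
         : Set (c ⊔ ℓ) where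
    field
      distinct     : ∀ i j → (∀ t → code i t B.≈ code j t) → i ≡ j
      alphabet     : Fin q → Carrier B
      alphabet-inj : ∀ s s′ → alphabet s B.≈ alphabet s′ → s ≡ s′
      in-alphabet  : ∀ i t → ∃ λ s → code i t B.≈ alphabet s
      dist-≥       : ∀ i j → i ≢ j → d ≤ hammingDistance (code i) (code j)
      dist-attained : Σ (Fin M) λ i → Σ (Fin M) λ j →
                        (i ≢ j) × (hammingDistance (code i) (code j) ≡ d)
      const-weight : ∀ i → weight (code i) ≡ w

-- Optimality of the parameters (n, M, d, w)_q:
--   D = nd - 2nw + (q/(q-1)) w² > 0  and  M = nd / D  (i.e. M·D = nd).
-- Only meaningful for q ≥ 2 (q/(q-1) undefined otherwise).
optimalDenom : (n d w r : ℕ) → ℚ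
optimalDenom n d w r =
  ((+ (n ℕ.* d)) / 1) ℚ.- ((+ (2 ℕ.* n ℕ.* w)) / 1)
    ℚ.+ ((+ (suc (suc r))) / suc r) ℚ.* ((+ (w ℕ.* w)) / 1)

IsOptimal : (n M d w q : ℕ) → Set
IsOptimal n M d w zero = ⊥
IsOptimal n M d w (suc zero) = ⊥
IsOptimal n M d w (suc (suc r)) =
  (0ℚ ℚ.< optimalDenom n d w r) × (((+ M) / 1) ℚ.* optimalDenom n d w r ≡ (+ (n ℕ.* d)) / 1)

-- Translating the positions by aᵢ turns the agreements between the codewords of aᵢ and aⱼ
-- into {x | f(x + (aⱼ - aᵢ)) = f(x)}, so two distinct codewords agree in exactly λ = k - 1
-- places, and likewise every codeword has |f⁻¹(0)| = 1 zero entry.  Writing n = 1 + (q - 1)k,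
-- the denominator nd - 2nw + q w² / (q - 1) of the optimality bound collapses to d = n - k + 1,
-- whence M = n = nd / d.

module Submission where

open import Defs
open import Level using (Level)
open import Data.Nat using (ℕ; zero; suc; _∸_; _+_; _*_; _/_; _≤_; _<_; NonZero; s≤s)
import Data.Nat.Properties as ℕₚ
open import Data.Nat.DivMod using (m*n/n≡m)
open import Data.Nat.Divisibility using (_∣_; divides)
import Data.Nat.Tactic.RingSolver as ℕ-Solver
open import Data.Fin using (Fin; zero; suc)
import Data.Fin.Properties as Finₚ
open import Data.Fin.Permutation using (Permutation; _⟨$⟩ʳ_; permutation)
open import Data.Integer as ℤ using (+_)
import Data.Integer.Properties as ℤₚ
import Data.Integer.Tactic.RingSolver as ℤ-Solver
open import Data.Rational as ℚ using (toℚᵘ)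
import Data.Rational.Properties as ℚₚ
open import Data.Rational.Unnormalised as ℚᵘ using (mkℚᵘ; *≡*)
import Data.Rational.Unnormalised.Properties as ℚᵘₚ
open import Data.Product using (∃; ∃₂; _×_; _,_; proj₁; proj₂)
open import Relation.Nullary using (Dec; yes; no; ¬_; ¬?; contradiction)
open import Relation.Unary using (Pred)
open import Relation.Binary.PropositionalEquality
  using (_≡_; _≢_; refl; sym; trans; cong; cong₂; subst; module ≡-Reasoning)
import Algebra.Properties.Group as GroupProperties
import Algebra.Properties.AbelianGroup as AbelianGroupProperties
import Algebra.Properties.CommutativeMonoid.Sum as Sum

private
  variable
    p q : Level

indicator : {P : Set p} → Dec P → ℕ
indicator (yes _) = 1
indicator (no _)  = 0

open Sum ℕₚ.+-0-commutativeMonoid using (sum; sum-permute)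

count≡sum : ∀ {n} {P : Pred (Fin n) p} (P? : ∀ i → Dec (P i)) →
            count P? ≡ sum (λ i → indicator (P? i))
count≡sum {n = zero}  P? = refl
count≡sum {n = suc n} P? with P? zero
... | yes _ = cong suc (count≡sum (λ i → P? (suc i)))
... | no _  = count≡sum (λ i → P? (suc i))

count-permute : ∀ {n} {P : Pred (Fin n) p} (P? : ∀ i → Dec (P i)) (π : Permutation n n) →
                count P? ≡ count (λ i → P? (π ⟨$⟩ʳ i))
count-permute P? π = begin
  count P?                               ≡⟨ count≡sum P? ⟩
  sum (λ i → indicator (P? i))           ≡⟨ sum-permute (λ i → indicator (P? i)) π ⟩
  sum (λ i → indicator (P? (π ⟨$⟩ʳ i)))  ≡⟨ count≡sum (λ i → P? (π ⟨$⟩ʳ i)) ⟨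
  count (λ i → P? (π ⟨$⟩ʳ i))            ∎
  where open ≡-Reasoning

count-cong : ∀ {n} {P : Pred (Fin n) p} {Q : Pred (Fin n) q}
             (P? : ∀ i → Dec (P i)) (Q? : ∀ i → Dec (Q i)) →
             (∀ i → P i → Q i) → (∀ i → Q i → P i) → count P? ≡ count Q?
count-cong {n = zero}  P? Q? P⇒Q Q⇒P = refl
count-cong {n = suc n} P? Q? P⇒Q Q⇒P with P? zero | Q? zero
... | yes _  | yes _  = cong suc (count-cong (λ i → P? (suc i)) (λ i → Q? (suc i))
                                             (λ i → P⇒Q (suc i)) (λ i → Q⇒P (suc i)))
... | no _   | no _   = count-cong (λ i → P? (suc i)) (λ i → Q? (suc i))
                                  (λ i → P⇒Q (suc i)) (λ i → Q⇒P (suc i))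
... | yes Pz | no ¬Qz = contradiction (P⇒Q zero Pz) ¬Qz
... | no ¬Pz | yes Qz = contradiction (Q⇒P zero Qz) ¬Pz

count-all : ∀ {n} {P : Pred (Fin n) p} (P? : ∀ i → Dec (P i)) → (∀ i → P i) → count P? ≡ n
count-all {n = zero}  P? all = refl
count-all {n = suc n} P? all with P? zero
... | yes _  = cong suc (count-all (λ i → P? (suc i)) (λ i → all (suc i)))
... | no ¬Pz = contradiction (all zero) ¬Pz

count-¬? : ∀ {n} {P : Pred (Fin n) p} (P? : ∀ i → Dec (P i)) →
           count (λ i → ¬? (P? i)) ≡ n ∸ count P?
count-¬? {n = n} P? = begin
  count (λ i → ¬? (P? i))                         ≡⟨ ℕₚ.m+n∸n≡m _ (count P?) ⟨
  count (λ i → ¬? (P? i)) + count P? ∸ count P?   ≡⟨ cong (_∸ count P?) (complement P?) ⟩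
  n ∸ count P?                                    ∎
  where
  open ≡-Reasoning
  complement : ∀ {n} {P : Pred (Fin n) p} (P? : ∀ i → Dec (P i)) →
               count (λ i → ¬? (P? i)) + count P? ≡ n
  complement {n = zero}  P? = refl
  complement {n = suc n} P? with P? zero
  ... | yes _ = trans (ℕₚ.+-suc _ _) (cong suc (complement (λ i → P? (suc i))))
  ... | no _  = cong suc (complement (λ i → P? (suc i)))

enumerate : ∀ {n} {P : Pred (Fin n) p} (P? : ∀ i → Dec (P i)) → Fin (count P?) → Fin n
enumerate {n = suc n} P? s with P? zero
enumerate {n = suc n} P? zero    | yes _ = zero
enumerate {n = suc n} P? (suc s) | yes _ = suc (enumerate (λ i → P? (suc i)) s)
enumerate {n = suc n} P? s       | no _  = suc (enumerate (λ i → P? (suc i)) s)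

enumerate-injective : ∀ {n} {P : Pred (Fin n) p} (P? : ∀ i → Dec (P i)) →
                      ∀ s s′ → enumerate P? s ≡ enumerate P? s′ → s ≡ s′
enumerate-injective {n = suc n} P? s s′ eq with P? zero
enumerate-injective {n = suc n} P? zero    zero     eq | yes _ = refl
enumerate-injective {n = suc n} P? (suc s) (suc s′) eq | yes _ =
  cong suc (enumerate-injective (λ i → P? (suc i)) s s′ (Finₚ.suc-injective eq))
enumerate-injective {n = suc n} P? s       s′       eq | no _  =
  enumerate-injective (λ i → P? (suc i)) s s′ (Finₚ.suc-injective eq)

enumerate-complete : ∀ {n} {P : Pred (Fin n) p} (P? : ∀ i → Dec (P i)) →
                     ∀ i → P i → ∃ λ s → enumerate P? s ≡ i
enumerate-complete {n = suc n} P? i Pi with P? zero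
enumerate-complete {n = suc n} P? zero    Pi | yes _ = zero , refl
enumerate-complete {n = suc n} P? (suc i) Pi | yes _ =
  let s , eq = enumerate-complete (λ i → P? (suc i)) i Pi in suc s , cong suc eq
enumerate-complete {n = suc n} P? zero    Pi | no ¬Pz = contradiction Pi ¬Pz
enumerate-complete {n = suc n} P? (suc i) Pi | no _ =
  let s , eq = enumerate-complete (λ i → P? (suc i)) i Pi in s , cong suc eq

distinctPair : ∀ {n} → 2 ≤ n → ∃₂ λ (i j : Fin n) → i ≢ j
distinctPair (s≤s (s≤s _)) = zero , suc zero , λ ()

module Translation {c ℓ} (A : FiniteAbelianGroup c ℓ) where

  open FiniteAbelianGroup A
  open GroupProperties group using (//-rightDividesˡ; //-rightDividesʳ)
  open AbelianGroupProperties abelianGroup using (xyx⁻¹≈y)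
  open import Relation.Binary.Reasoning.Setoid setoid

  index : Carrier → Fin size
  index x = proj₁ (elem-surj x)

  elem-index : ∀ x → elem (index x) ≈ x
  elem-index x = proj₂ (elem-surj x)

  translation : Carrier → Permutation size size
  translation g = permutation (shift g) (shift (g ⁻¹)) shift-inverseˡ shift-inverseʳ
    where
    shift : Carrier → Fin size → Fin size
    shift h t = index (elem t ∙ h)
    shift-inverseˡ : ∀ t → shift g (shift (g ⁻¹) t) ≡ t
    shift-inverseˡ t = elem-inj _ _ (begin
      elem (shift g (shift (g ⁻¹) t)) ≈⟨ elem-index _ ⟩
      elem (shift (g ⁻¹) t) ∙ g       ≈⟨ ∙-congʳ (elem-index _) ⟩
      elem t ∙ g ⁻¹ ∙ g               ≈⟨ //-rightDividesˡ g (elem t) ⟩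
      elem t                          ∎)
    shift-inverseʳ : ∀ t → shift (g ⁻¹) (shift g t) ≡ t
    shift-inverseʳ t = elem-inj _ _ (begin
      elem (shift (g ⁻¹) (shift g t)) ≈⟨ elem-index _ ⟩
      elem (shift g t) ∙ g ⁻¹         ≈⟨ ∙-congʳ (elem-index _) ⟩
      elem t ∙ g ∙ g ⁻¹               ≈⟨ //-rightDividesʳ g (elem t) ⟩
      elem t                          ∎)

  elem-translation : ∀ g t → elem (translation g ⟨$⟩ʳ t) ≈ elem t ∙ g
  elem-translation g t = elem-index (elem t ∙ g)

  x∙y∙[z-y]≈x∙z : ∀ x y z → x ∙ y ∙ (z - y) ≈ x ∙ z
  x∙y∙[z-y]≈x∙z x y z = begin
    x ∙ y ∙ (z - y)     ≈⟨ assoc x y (z - y) ⟩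
    x ∙ (y ∙ (z - y))   ≈⟨ ∙-congˡ (assoc y z (y ⁻¹)) ⟨
    x ∙ (y ∙ z ∙ y ⁻¹)  ≈⟨ ∙-congˡ (xyx⁻¹≈y y z) ⟩
    x ∙ z               ∎

open FiniteAbelianGroup using (Carrier; size; ε; _≈_)

module Codewords {c₁ ℓ₁ c₂ ℓ₂}
  (A : FiniteAbelianGroup c₁ ℓ₁) (B : FiniteAbelianGroup c₂ ℓ₂)
  (f : Carrier A → Carrier B) (f-cong : ∀ x y → _≈_ A x y → _≈_ B (f x) (f y)) where

  private
    module A = FiniteAbelianGroup A
    module B = FiniteAbelianGroup B
  open Translation A
  open GroupProperties A.group using (x∙y⁻¹≈ε⇒x≈y)

  f-translation : ∀ i t → f (A.elem (translation (A.elem i) ⟨$⟩ʳ t)) B.≈ codeword A B f i t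
  f-translation i t = f-cong _ _ (elem-translation (A.elem i) t)

  agreements≡lambda : ∀ i j → count (λ t → codeword A B f i t B.≟ codeword A B f j t)
                            ≡ lambda A B f (A.elem j A.- A.elem i)
  agreements≡lambda i j =
    sym (trans (count-permute (λ t → f (A.elem t A.∙ α) B.≟ f (A.elem t)) τ) (count-cong _ _ to from))
    where
    α = A.elem j A.- A.elem i
    τ = translation (A.elem i)
    x : Fin A.size → A.Carrier
    x t = A.elem (τ ⟨$⟩ʳ t)
    f-translation-α : ∀ t → f (x t A.∙ α) B.≈ codeword A B f j t
    f-translation-α t = f-cong _ _
      (A.trans (A.∙-congʳ (elem-translation (A.elem i) t)) (x∙y∙[z-y]≈x∙z _ _ _))
    to : ∀ t → f (x t A.∙ α) B.≈ f (x t) → codeword A B f i t B.≈ codeword A B f j t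
    to t eq = B.trans (B.sym (f-translation i t)) (B.trans (B.sym eq) (f-translation-α t))
    from : ∀ t → codeword A B f i t B.≈ codeword A B f j t → f (x t A.∙ α) B.≈ f (x t)
    from t eq = B.trans (f-translation-α t) (B.trans (B.sym eq) (B.sym (f-translation i t)))

  zeros≡preimageSize : ∀ i → count (λ t → codeword A B f i t B.≟ B.ε) ≡ preimageSize A B f B.ε
  zeros≡preimageSize i = sym (trans (count-permute (λ t → f (A.elem t) B.≟ B.ε) τ)
    (count-cong (λ t → f (A.elem (τ ⟨$⟩ʳ t)) B.≟ B.ε) (λ t → codeword A B f i t B.≟ B.ε)
                (λ t → B.trans (B.sym (f-translation i t))) (λ t → B.trans (f-translation i t))))
    where τ = translation (A.elem i)

  difference≉ε : ∀ {i j} → i ≢ j → ¬ (A.elem j A.- A.elem i A.≈ A.ε)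
  difference≉ε i≢j aⱼ-aᵢ≈ε = i≢j (sym (A.elem-inj _ _ (x∙y⁻¹≈ε⇒x≈y _ _ aⱼ-aᵢ≈ε)))

  imageElem : Fin (imageSize A B f) → B.Carrier
  imageElem s = B.elem (enumerate (inImage? A B f) s)

  codeword-inImage : ∀ i t → ∃ λ s → codeword A B f i t B.≈ imageElem s
  codeword-inImage i t =
    let b , bᵢₜ = B.elem-surj (codeword A B f i t)
        s , s↦b = enumerate-complete (inImage? A B f) b (index (A.elem t A.∙ A.elem i) ,
                    B.trans (f-cong _ _ (elem-index _)) (B.sym bᵢₜ))
    in s , B.trans (B.sym bᵢₜ) (B.reflexive (cong B.elem (sym s↦b)))

  codeword-isConstantWeightCode :
    ∀ {m λ′ z} → IsZDB A B f A.size m λ′ → 2 ≤ A.size → λ′ < A.size → preimageSize A B f B.ε ≡ z →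
    IsConstantWeightCode B A.size A.size (A.size ∸ λ′) (A.size ∸ z) m (codeword A B f)
  codeword-isConstantWeightCode {λ′ = λ′} (_ , refl , balanced) 2≤n λ′<n refl = record
    { distinct      = distinct
    ; alphabet      = imageElem
    ; alphabet-inj  = λ s s′ eq → enumerate-injective (inImage? A B f) s s′ (B.elem-inj _ _ eq)
    ; in-alphabet   = codeword-inImage
    ; dist-≥        = λ i j i≢j → ℕₚ.≤-reflexive (sym (distance i≢j))
    ; dist-attained = let i , j , i≢j = distinctPair 2≤n in i , j , i≢j , distance i≢j
    ; const-weight  = λ i → trans (count-¬? (λ t → codeword A B f i t B.≟ B.ε))
                                  (cong (A.size ∸_) (zeros≡preimageSize i))
    }
    where
    agreements : ∀ {i j} → i ≢ j → count (λ t → codeword A B f i t B.≟ codeword A B f j t) ≡ λ′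
    agreements {i} {j} i≢j = trans (agreements≡lambda i j) (balanced _ (difference≉ε i≢j))
    distance : ∀ {i j} → i ≢ j → hammingDistance B (codeword A B f i) (codeword A B f j) ≡ A.size ∸ λ′
    distance {i} {j} i≢j = trans (count-¬? (λ t → codeword A B f i t B.≟ codeword A B f j t))
                                 (cong (A.size ∸_) (agreements i≢j))
    distinct : ∀ i j → (∀ t → codeword A B f i t B.≈ codeword A B f j t) → i ≡ j
    distinct i j agree with i Finₚ.≟ j
    ... | yes i≡j = i≡j
    ... | no i≢j  = contradiction (trans (sym (agreements i≢j)) (count-all _ agree)) (ℕₚ.<⇒≢ λ′<n)

toℚᵘ-/ : ∀ i d → toℚᵘ (i ℚ./ suc d) ℚᵘ.≃ mkℚᵘ i d
toℚᵘ-/ i d = ℚₚ.toℚᵘ-fromℚᵘ (mkℚᵘ i d)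

toℚᵘ-optimalDenom : ∀ n d w r → toℚᵘ (optimalDenom n d w r) ℚᵘ.≃
  (mkℚᵘ (+ (n * d)) 0 ℚᵘ.- mkℚᵘ (+ (2 * n * w)) 0) ℚᵘ.+ mkℚᵘ (+ suc (suc r)) r ℚᵘ.* mkℚᵘ (+ (w * w)) 0
toℚᵘ-optimalDenom n d w r = begin
  toℚᵘ ((nd ℚ.- 2nw) ℚ.+ q/[q-1] ℚ.* ww)
    ≈⟨ ℚₚ.toℚᵘ-homo-+ (nd ℚ.- 2nw) (q/[q-1] ℚ.* ww) ⟩
  toℚᵘ (nd ℚ.- 2nw) ℚᵘ.+ toℚᵘ (q/[q-1] ℚ.* ww)
    ≈⟨ ℚᵘₚ.+-cong (ℚₚ.toℚᵘ-homo-+ nd (ℚ.- 2nw)) (ℚₚ.toℚᵘ-homo-* q/[q-1] ww) ⟩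
  (toℚᵘ nd ℚᵘ.+ toℚᵘ (ℚ.- 2nw)) ℚᵘ.+ toℚᵘ q/[q-1] ℚᵘ.* toℚᵘ ww
    ≈⟨ ℚᵘₚ.+-cong (ℚᵘₚ.+-cong (toℚᵘ-/ (+ (n * d)) 0) toℚᵘ-[-2nw])
                  (ℚᵘₚ.*-cong (toℚᵘ-/ (+ suc (suc r)) r) (toℚᵘ-/ (+ (w * w)) 0)) ⟩
  (mkℚᵘ (+ (n * d)) 0 ℚᵘ.- mkℚᵘ (+ (2 * n * w)) 0) ℚᵘ.+ mkℚᵘ (+ suc (suc r)) r ℚᵘ.* mkℚᵘ (+ (w * w)) 0 ∎
  where
  open ℚᵘₚ.≃-Reasoning
  nd = + (n * d) ℚ./ 1
  2nw = + (2 * n * w) ℚ./ 1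
  q/[q-1] = + suc (suc r) ℚ./ suc r
  ww = + (w * w) ℚ./ 1
  toℚᵘ-[-2nw] : toℚᵘ (ℚ.- 2nw) ℚᵘ.≃ ℚᵘ.- mkℚᵘ (+ (2 * n * w)) 0
  toℚᵘ-[-2nw] = ℚᵘₚ.≃-trans (ℚₚ.toℚᵘ-homo‿- 2nw) (ℚᵘₚ.-‿cong (toℚᵘ-/ (+ (2 * n * w)) 0))

[a-b]+c/[1+r]*e≃d : ∀ a b c e d r → a * suc r + c * e ≡ (d + b) * suc r →
  (mkℚᵘ (+ a) 0 ℚᵘ.- mkℚᵘ (+ b) 0) ℚᵘ.+ mkℚᵘ (+ c) r ℚᵘ.* mkℚᵘ (+ e) 0 ℚᵘ.≃ mkℚᵘ (+ d) 0
[a-b]+c/[1+r]*e≃d a b c e d r h rewrite ℕₚ.*-identityʳ r = *≡* (begin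
  ((+ a ℤ.* + 1 ℤ.+ ℤ.- + b ℤ.* + 1) ℤ.* s ℤ.+ (+ c ℤ.* + e) ℤ.* + 1) ℤ.* + 1
    ≡⟨ regroup (+ a) (+ b) (+ c) (+ e) s ⟩
  (+ a ℤ.* s ℤ.+ + c ℤ.* + e) ℤ.- + b ℤ.* s  ≡⟨ cong (ℤ._- + b ℤ.* s) h′ ⟩
  (+ d ℤ.+ + b) ℤ.* s ℤ.- + b ℤ.* s          ≡⟨ cancel (+ d) (+ b) s ⟩
  + d ℤ.* s                                  ≡⟨ cong (λ x → + d ℤ.* + suc x) (ℕₚ.+-identityʳ r) ⟨
  + d ℤ.* + suc (r + 0)                      ∎)
  where
  open ≡-Reasoning
  s = + suc r
  regroup : ∀ a b c e s → ((a ℤ.* + 1 ℤ.+ ℤ.- b ℤ.* + 1) ℤ.* s ℤ.+ (c ℤ.* e) ℤ.* + 1) ℤ.* + 1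
                        ≡ (a ℤ.* s ℤ.+ c ℤ.* e) ℤ.- b ℤ.* s
  regroup = ℤ-Solver.solve-∀
  cancel : ∀ d b s → (d ℤ.+ b) ℤ.* s ℤ.- b ℤ.* s ≡ d ℤ.* s
  cancel = ℤ-Solver.solve-∀
  h′ : + a ℤ.* s ℤ.+ + c ℤ.* + e ≡ (+ d ℤ.+ + b) ℤ.* s
  h′ = begin
    + a ℤ.* s ℤ.+ + c ℤ.* + e   ≡⟨ cong₂ ℤ._+_ (ℤₚ.pos-* a (suc r)) (ℤₚ.pos-* c e) ⟨
    + (a * suc r) ℤ.+ + (c * e) ≡⟨ ℤₚ.pos-+ (a * suc r) (c * e) ⟨
    + (a * suc r + c * e)       ≡⟨ cong +_ h ⟩
    + ((d + b) * suc r)         ≡⟨ ℤₚ.pos-* (d + b) (suc r) ⟩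
    + (d + b) ℤ.* s             ≡⟨ cong (ℤ._* s) (ℤₚ.pos-+ d b) ⟩
    (+ d ℤ.+ + b) ℤ.* s         ∎

optimalDenom≡d : ∀ n d w r → n * d * suc r + suc (suc r) * (w * w) ≡ (d + 2 * n * w) * suc r →
                 optimalDenom n d w r ≡ + d ℚ./ 1
optimalDenom≡d n d w r h = ℚₚ.toℚᵘ-injective (begin
  toℚᵘ (optimalDenom n d w r) ≈⟨ toℚᵘ-optimalDenom n d w r ⟩
  _                           ≈⟨ [a-b]+c/[1+r]*e≃d (n * d) (2 * n * w) (suc (suc r)) (w * w) d r h ⟩
  mkℚᵘ (+ d) 0                ≈⟨ toℚᵘ-/ (+ d) 0 ⟨
  toℚᵘ (+ d ℚ./ 1)            ∎)
  where open ℚᵘₚ.≃-Reasoning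

/1-homo-* : ∀ m n → (+ m ℚ./ 1) ℚ.* (+ n ℚ./ 1) ≡ + (m * n) ℚ./ 1
/1-homo-* m n = ℚₚ.toℚᵘ-injective (begin
  toℚᵘ ((+ m ℚ./ 1) ℚ.* (+ n ℚ./ 1))     ≈⟨ ℚₚ.toℚᵘ-homo-* (+ m ℚ./ 1) (+ n ℚ./ 1) ⟩
  toℚᵘ (+ m ℚ./ 1) ℚᵘ.* toℚᵘ (+ n ℚ./ 1) ≈⟨ ℚᵘₚ.*-cong (toℚᵘ-/ (+ m) 0) (toℚᵘ-/ (+ n) 0) ⟩
  mkℚᵘ (+ m ℤ.* + n) 0                    ≈⟨ ℚᵘₚ.≃-reflexive (cong (λ i → mkℚᵘ i 0) (ℤₚ.pos-* m n)) ⟨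
  mkℚᵘ (+ (m * n)) 0                      ≈⟨ toℚᵘ-/ (+ (m * n)) 0 ⟨
  toℚᵘ (+ (m * n) ℚ./ 1)                  ∎)
  where open ℚᵘₚ.≃-Reasoning

m∸n≡m∸[1+n]+1 : ∀ {m n} → n < m → m ∸ n ≡ m ∸ suc n + 1
m∸n≡m∸[1+n]+1 {m} {n} n<m = begin
  suc m ∸ suc n  ≡⟨ cong (_∸ suc n) (ℕₚ.+-comm 1 m) ⟩
  m + 1 ∸ suc n  ≡⟨ ℕₚ.+-∸-comm 1 n<m ⟩
  m ∸ suc n + 1  ∎
  where open ≡-Reasoning

[1+k+x]∸k+1≡2+x : ∀ k x → suc (k + x) ∸ k + 1 ≡ suc (suc x)
[1+k+x]∸k+1≡2+x k x = begin
  suc (k + x) ∸ k + 1 ≡⟨ cong (λ y → y ∸ k + 1) (ℕₚ.+-suc k x) ⟨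
  k + suc x ∸ k + 1   ≡⟨ cong (_+ 1) (ℕₚ.m+n∸m≡n k (suc x)) ⟩
  suc x + 1           ≡⟨ ℕₚ.+-comm (suc x) 1 ⟩
  suc (suc x)         ∎
  where open ≡-Reasoning

optimalDenom-code : ∀ r k → optimalDenom (suc (suc r * k)) (suc (suc (r * k))) (suc r * k) r
                            ≡ + suc (suc (r * k)) ℚ./ 1
optimalDenom-code r k =
  optimalDenom≡d (suc (suc r * k)) (suc (suc (r * k))) (suc r * k) r (cross-multiplied r k)
  where
  cross-multiplied : ∀ r k →
    suc (suc r * k) * suc (suc (r * k)) * suc r + suc (suc r) * (suc r * k * (suc r * k))
    ≡ (suc (suc (r * k)) + 2 * suc (suc r * k) * (suc r * k)) * suc r
  cross-multiplied = ℕ-Solver.solve-∀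

isOptimal-code : ∀ {n} k r → n ≡ suc (suc r * k) → IsOptimal n n (n ∸ k + 1) (n ∸ 1) (suc (suc r))
isOptimal-code k r refl rewrite [1+k+x]∸k+1≡2+x k (r * k) | optimalDenom-code r k =
  ℚₚ.positive⁻¹ _ {{ℚₚ.normalize-pos (suc (suc (r * k))) 1}}
  , /1-homo-* (suc (suc r * k)) (suc (suc (r * k)))

theorem4 : {c₁ ℓ₁ c₂ ℓ₂ : Level}
    (A : FiniteAbelianGroup c₁ ℓ₁) (B : FiniteAbelianGroup c₂ ℓ₂)
    (f : Carrier A → Carrier B)
    (f-cong : ∀ x y → _≈_ A x y → _≈_ B (f x) (f y))
    (k : ℕ) .{{_ : NonZero k}}
    → k ∣ (size A ∸ 1)
    → 2 ≤ size A
    → IsZDB A B f (size A) ((size A ∸ 1) / k + 1) (k ∸ 1)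
    → TypeA A B f
    → preimageSize A B f (ε B) ≡ 1
    → IsConstantWeightCode B (size A) (size A) (size A ∸ k + 1) (size A ∸ 1)
        ((size A ∸ 1) / k + 1) (codeword A B f)
      × IsOptimal (size A) (size A) (size A ∸ k + 1) (size A ∸ 1) ((size A ∸ 1) / k + 1)
theorem4 A B f f-cong k (divides zero n∸1≡0) 2≤n _ _ _ =
  contradiction n∸1≡0 (ℕₚ.m>n⇒m∸n≢0 2≤n)
theorem4 A B f f-cong k@(suc _) (divides (suc r) n∸1≡[1+r]k) 2≤n zdb _ zeros≡1 =
    subst (λ d → IsConstantWeightCode B n n d (n ∸ 1) ((n ∸ 1) / k + 1) (codeword A B f))
          (m∸n≡m∸[1+n]+1 k≤n)
          (Codewords.codeword-isConstantWeightCode A B f f-cong zdb 2≤n k≤n zeros≡1)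
  , subst (IsOptimal n n (n ∸ k + 1) (n ∸ 1)) (sym q≡2+r) (isOptimal-code k r n≡1+[1+r]k)
  where
  n = size A
  n≡1+[1+r]k : n ≡ suc (suc r * k)
  n≡1+[1+r]k = trans (sym (ℕₚ.m∸n+n≡m (ℕₚ.<⇒≤ 2≤n)))
                     (trans (cong (_+ 1) n∸1≡[1+r]k) (ℕₚ.+-comm _ 1))
  k≤n : k ≤ n
  k≤n = subst (k ≤_) (sym n≡1+[1+r]k) (ℕₚ.m≤n⇒m≤1+n (ℕₚ.m≤n*m k (suc r)))
  q≡2+r : (n ∸ 1) / k + 1 ≡ suc (suc r)
  q≡2+r = trans (cong (λ m → m / k + 1) n∸1≡[1+r]k)
                (trans (cong (_+ 1) (m*n/n≡m (suc r) k)) (ℕₚ.+-comm (suc r) 1))
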